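{- For all $n \ge 1$, the zombie number of the $n$-dimensional hypercube $Q_n$ is $z(Q_n) = \lceil 2n/3 \rceil$.
   Context: Deterministic Zombies and Survivors: on a graph, the zombie player places zombies on vertices, then the survivor chooses a vertex; players then alternate turns, zombies first. On a turn the survivor moves to an adjacent vertex or stays still; each zombie must move on every turn, to a neighbor strictly closer (in graph distance) to the survivor's current vertex, with zombies allowed to coordinate among such moves. Zombies win if some zombie occupies the survivor's vertex. The zombie number $z(G)$ is the minimum number of zombies guaranteeing a win. -}

module Defs where

open import Level using (Level; _⊔_) renaming (suc to lsuc)
open import Data.Nat using (ℕ; zero; suc; _+_; _*_; _≤_; _<_)
open import Data.Nat.DivMod using (_/_)
open import Data.Bool using (Bool; _≟_)
open import Relation.Nullary using (¬_; yes; no)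
open import Data.Fin using (Fin)
open import Data.Vec using (Vec; []; _∷_; lookup)
open import Data.Product using (Σ; ∃; _×_; _,_)
open import Data.Sum using (_⊎_)
open import Relation.Binary.PropositionalEquality using (_≡_; _≢_)

record Graph : Set₁ where
  field
    V   : Set
    Adj : V → V → Set

open Graph public

module _ (G : Graph) where

  data Walk : V G → V G → ℕ → Set where
    here  : ∀ {u} → Walk u u 0
    there : ∀ {u v w d} → Adj G u v → Walk v w d → Walk u w (suc d)

  Dist : V G → V G → ℕ → Set
  Dist u v d = Walk u v d × (∀ m → Walk u v m → d ≤ m)

  Closer : V G → V G → V G → Set
  Closer w z s = Σ ℕ λ d₁ → Σ ℕ λ d₂ → Dist w s d₁ × Dist z s d₂ × d₁ < d₂

  Caught : ∀ {k} → Vec (V G) k → V G → Set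
  Caught {k} Z s = Σ (Fin k) λ i → lookup Z i ≡ s

  ZMove : ∀ {k} → Vec (V G) k → Vec (V G) k → V G → Set
  ZMove {k} Z Z' s = ∀ (i : Fin k) →
    Adj G (lookup Z i) (lookup Z' i) × Closer (lookup Z' i) (lookup Z i) s

  -- ZWin Z s : zombies at Z, survivor at s, zombies to move; the zombies
  -- can force a capture in finitely many rounds (inductive = attractor).
  data ZWin {k} (Z : Vec (V G) k) (s : V G) : Set where
    caught : Caught Z s → ZWin Z s
    move   : (Z' : Vec (V G) k) → ZMove Z Z' s →
             (Caught Z' s ⊎
              (∀ s' → (s' ≡ s ⊎ Adj G s s') → ZWin Z' s')) →
             ZWin Z s

  ZombiesWin : ℕ → Set
  ZombiesWin k = Σ (Vec (V G) k) λ Z → ∀ s → ZWin Z s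

  ZombieNumber : ℕ → Set
  ZombieNumber m = ZombiesWin m × (∀ k → k < m → ¬ ZombiesWin k)

hamming : ∀ {n} → Vec Bool n → Vec Bool n → ℕ
hamming []       []       = 0
hamming (x ∷ xs) (y ∷ ys) with x ≟ y
... | yes _ = hamming xs ys
... | no  _ = suc (hamming xs ys)

Q : ℕ → Graph
Q n = record { V = Vec Bool n ; Adj = λ u v → hamming u v ≡ 1 }

ceil3 : ℕ → ℕ
ceil3 m = (m + 2) / 3

-- Zombies. Give every zombie a blind set of coordinates and let it step towards the survivor only
-- along coordinates outside it. The sum of the zombies' distances to the survivor outside their
-- blind sets drops by k on each zombie move and grows by less than k on each survivor move, since
-- the flipped coordinate lies in some blind set. While every zombie is at distance ≥ 2 each of these
-- outside distances is positive: a zombie agreeing with the survivor outside a blind set of size ≤ 1,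
-- or two antipodal zombies sharing a blind set of size ≤ 3, would put some zombie within distance 1.
-- So eventually a zombie is adjacent to the survivor, and then all zombies step straight at it.
-- Antipodal pairs sharing blind sets of size 3 cover the n coordinates with ⌈2n/3⌉ zombies.
--
-- Survivor. Against k < ⌈2n/3⌉ zombies the survivor keeps every zombie at distance ≥ 2 and keeps
-- (number of zombies at odd distance) + k < n. After the zombies move, a zombie at distance 1 or 2
-- forbids flipping the 1 or 2 coordinates separating it from the survivor, and it is at distance 2
-- only if it was at odd distance before, so fewer than n coordinates are forbidden. Flipping a free
-- one keeps all distances ≥ 2 and, as every distance changed parity twice, preserves the odd count.
-- A start exists by counting inside the parity class that puts at most k/2 zombies at odd distance:
-- its 2^(n-1) vertices outnumber the at most k + (n-1)·k/2 of them within distance 1 of a zombie.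

module Submission where

open import Defs
open import Data.Nat using (ℕ; _*_; _≤_)

open import Algebra.Bundles using (CommutativeRing)
open import Data.Bool using (Bool; true; false; not; _xor_)
open import Data.Bool.Properties
  using (xor-comm; xor-same; not-involutive; not-distribˡ-xor; not-distribʳ-xor; xor-∧-commutativeRing)
open import Data.Fin as F using (Fin)
open import Data.Fin.Properties using (any?)
open import Data.Nat using (zero; suc; _+_; _<_; _^_; _<ᵇ_; z≤n; s≤s; z<s)
open import Data.Nat.DivMod using (m/n≡1+[m∸n]/n; m/n*n≤m)
open import Data.Nat.Properties
open import Data.Nat.Tactic.RingSolver using (solve-∀)
open import Data.Product using (Σ; _×_; _,_; proj₁; proj₂)
open import Data.Sum using (_⊎_; inj₁; inj₂)
open import Data.Vec using (Vec; []; _∷_; head; tail; lookup; map; zipWith; replicate; _[_]%=_)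
open import Data.Vec.Properties using (zipWith-comm; lookup-zipWith; lookup-map)
open import Function using (_∘_)
open import Relation.Binary.PropositionalEquality
open import Relation.Nullary using (¬_; yes; no; contradiction)
open import Algebra.Properties.CommutativeSemigroup +-commutativeSemigroup using (interchange)
open import Algebra.Properties.CommutativeSemigroup (CommutativeRing.+-commutativeSemigroup xor-∧-commutativeRing)
  using () renaming (interchange to xor-interchange)

bit : Bool → ℕ
bit false = 0
bit true  = 1

weight : ∀ {n} → Vec Bool n → ℕ
weight []       = 0
weight (x ∷ xs) = bit x + weight xs

infixl 6 _⊕_
_⊕_ : ∀ {n} → Vec Bool n → Vec Bool n → Vec Bool n
_⊕_ = zipWith _xor_

dist : ∀ {n} → Vec Bool n → Vec Bool n → ℕ
dist u v = weight (u ⊕ v)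

hamming≡dist : ∀ {n} (u v : Vec Bool n) → hamming u v ≡ dist u v
hamming≡dist []           []           = refl
hamming≡dist (false ∷ xs) (false ∷ ys) = hamming≡dist xs ys
hamming≡dist (false ∷ xs) (true  ∷ ys) = cong suc (hamming≡dist xs ys)
hamming≡dist (true  ∷ xs) (false ∷ ys) = cong suc (hamming≡dist xs ys)
hamming≡dist (true  ∷ xs) (true  ∷ ys) = hamming≡dist xs ys

dist-self : ∀ {n} (u : Vec Bool n) → dist u u ≡ 0
dist-self []      = refl
dist-self (x ∷ u) = cong₂ _+_ (cong bit (xor-same x)) (dist-self u)

≡⇒dist≡0 : ∀ {n} {u v : Vec Bool n} → u ≡ v → dist u v ≡ 0
≡⇒dist≡0 {u = u} refl = dist-self u

dist-sym : ∀ {n} (u v : Vec Bool n) → dist u v ≡ dist v u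
dist-sym u v = cong weight (zipWith-comm xor-comm u v)

dist≡0⇒≡ : ∀ {n} {u v : Vec Bool n} → dist u v ≡ 0 → u ≡ v
dist≡0⇒≡ {u = []}         {[]}         _ = refl
dist≡0⇒≡ {u = false ∷ xs} {false ∷ ys} e = cong (false ∷_) (dist≡0⇒≡ e)
dist≡0⇒≡ {u = true  ∷ xs} {true  ∷ ys} e = cong (true ∷_) (dist≡0⇒≡ e)

bit-xor-triangle : ∀ x y z → bit (x xor z) ≤ bit (x xor y) + bit (y xor z)
bit-xor-triangle false false false = z≤n
bit-xor-triangle false false true  = ≤-refl
bit-xor-triangle false true  false = z≤n
bit-xor-triangle false true  true  = ≤-refl
bit-xor-triangle true  false false = ≤-refl
bit-xor-triangle true  false true  = z≤n
bit-xor-triangle true  true  false = ≤-refl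
bit-xor-triangle true  true  true  = z≤n

dist-triangle : ∀ {n} (u v w : Vec Bool n) → dist u w ≤ dist u v + dist v w
dist-triangle []       []       []       = z≤n
dist-triangle (x ∷ xs) (y ∷ ys) (z ∷ zs) = begin
  bit (x xor z) + dist xs zs
    ≤⟨ +-mono-≤ (bit-xor-triangle x y z) (dist-triangle xs ys zs) ⟩
  (bit (x xor y) + bit (y xor z)) + (dist xs ys + dist ys zs)
    ≡⟨ interchange (bit (x xor y)) (bit (y xor z)) (dist xs ys) (dist ys zs) ⟩
  (bit (x xor y) + dist xs ys) + (bit (y xor z) + dist ys zs) ∎
  where open ≤-Reasoning

⊕-self : ∀ {n} (v : Vec Bool n) → v ⊕ v ≡ replicate n false
⊕-self []      = refl
⊕-self (x ∷ v) = cong₂ _∷_ (xor-same x) (⊕-self v)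

weight-replicate-false : ∀ n → weight (replicate n false) ≡ 0
weight-replicate-false zero    = refl
weight-replicate-false (suc n) = weight-replicate-false n

dist-flip : ∀ {n} (s : Vec Bool n) t → dist s (s [ t ]%= not) ≡ 1
dist-flip (false ∷ s) F.zero    = cong suc (dist-self s)
dist-flip (true  ∷ s) F.zero    = cong suc (dist-self s)
dist-flip (x     ∷ s) (F.suc t) = cong₂ _+_ (cong bit (xor-same x)) (dist-flip s t)

dist≡1⇒flip : ∀ {n} (s s′ : Vec Bool n) → dist s s′ ≡ 1 → Σ (Fin n) λ t → s′ ≡ s [ t ]%= not
dist≡1⇒flip []          []           ()
dist≡1⇒flip (false ∷ s) (true  ∷ s′) e = F.zero , cong (true ∷_) (sym (dist≡0⇒≡ (suc-injective e)))
dist≡1⇒flip (true  ∷ s) (false ∷ s′) e = F.zero , cong (false ∷_) (sym (dist≡0⇒≡ (suc-injective e)))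
dist≡1⇒flip (false ∷ s) (false ∷ s′) e = let t , s′≡ = dist≡1⇒flip s s′ e in F.suc t , cong (false ∷_) s′≡
dist≡1⇒flip (true  ∷ s) (true  ∷ s′) e = let t , s′≡ = dist≡1⇒flip s s′ e in F.suc t , cong (true ∷_) s′≡

dist-flip-agreeing : ∀ {n} (z s : Vec Bool n) t → lookup z t ≡ lookup s t → dist z (s [ t ]%= not) ≡ suc (dist z s)
dist-flip-agreeing (false ∷ z) (false ∷ s) F.zero    _ = refl
dist-flip-agreeing (true  ∷ z) (true  ∷ s) F.zero    _ = refl
dist-flip-agreeing (x     ∷ z) (y     ∷ s) (F.suc t) e =
  trans (cong (bit (x xor y) +_) (dist-flip-agreeing z s t e)) (+-suc (bit (x xor y)) (dist z s))

-- Distance outside a set of coordinates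

distOutside : ∀ {n} → Vec Bool n → Vec Bool n → Vec Bool n → ℕ
distOutside []          []       []       = 0
distOutside (true  ∷ h) (_ ∷ xs) (_ ∷ ys) = distOutside h xs ys
distOutside (false ∷ h) (x ∷ xs) (y ∷ ys) = bit (x xor y) + distOutside h xs ys

distOutside-self : ∀ {n} (h u : Vec Bool n) → distOutside h u u ≡ 0
distOutside-self []          []      = refl
distOutside-self (true  ∷ h) (_ ∷ u) = distOutside-self h u
distOutside-self (false ∷ h) (x ∷ u) = cong₂ _+_ (cong bit (xor-same x)) (distOutside-self h u)

distOutside≤dist : ∀ {n} (h u v : Vec Bool n) → distOutside h u v ≤ dist u v
distOutside≤dist []          []       []       = z≤n
distOutside≤dist (true  ∷ h) (x ∷ xs) (y ∷ ys) = ≤-trans (distOutside≤dist h xs ys) (m≤n+m _ (bit (x xor y)))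
distOutside≤dist (false ∷ h) (x ∷ xs) (y ∷ ys) = +-monoʳ-≤ (bit (x xor y)) (distOutside≤dist h xs ys)

distOutside-none : ∀ {n} (u v : Vec Bool n) → distOutside (replicate n false) u v ≡ dist u v
distOutside-none []       []       = refl
distOutside-none (x ∷ xs) (y ∷ ys) = cong (bit (x xor y) +_) (distOutside-none xs ys)

distOutside-triangle : ∀ {n} (h u v w : Vec Bool n) →
                       distOutside h u w ≤ distOutside h u v + distOutside h v w
distOutside-triangle []          []       []       []       = z≤n
distOutside-triangle (true  ∷ h) (_ ∷ xs) (_ ∷ ys) (_ ∷ zs) = distOutside-triangle h xs ys zs
distOutside-triangle (false ∷ h) (x ∷ xs) (y ∷ ys) (z ∷ zs) = begin
  bit (x xor z) + distOutside h xs zs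
    ≤⟨ +-mono-≤ (bit-xor-triangle x y z) (distOutside-triangle h xs ys zs) ⟩
  (bit (x xor y) + bit (y xor z)) + (distOutside h xs ys + distOutside h ys zs)
    ≡⟨ interchange (bit (x xor y)) (bit (y xor z)) (distOutside h xs ys) (distOutside h ys zs) ⟩
  (bit (x xor y) + distOutside h xs ys) + (bit (y xor z) + distOutside h ys zs) ∎
  where open ≤-Reasoning

distOutside-flip : ∀ {n} (h s : Vec Bool n) t → lookup h t ≡ true → distOutside h s (s [ t ]%= not) ≡ 0
distOutside-flip (true  ∷ h) (_ ∷ s) F.zero    _ = distOutside-self h s
distOutside-flip (true  ∷ h) (_ ∷ s) (F.suc t) e = distOutside-flip h s t e
distOutside-flip (false ∷ h) (x ∷ s) (F.suc t) e = cong₂ _+_ (cong bit (xor-same x)) (distOutside-flip h s t e)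

distOutside≡0⇒dist+dist≡weight : ∀ {n} (h z s : Vec Bool n) →
                                 distOutside h z s ≡ 0 → dist z s + dist (z ⊕ h) s ≡ weight h
distOutside≡0⇒dist+dist≡weight []          []           []           e = refl
distOutside≡0⇒dist+dist≡weight (false ∷ h) (false ∷ xs) (false ∷ ys) e = distOutside≡0⇒dist+dist≡weight h xs ys e
distOutside≡0⇒dist+dist≡weight (false ∷ h) (true  ∷ xs) (true  ∷ ys) e = distOutside≡0⇒dist+dist≡weight h xs ys e
distOutside≡0⇒dist+dist≡weight (true  ∷ h) (false ∷ xs) (false ∷ ys) e =
  trans (+-suc _ _) (cong suc (distOutside≡0⇒dist+dist≡weight h xs ys e))
distOutside≡0⇒dist+dist≡weight (true  ∷ h) (true  ∷ xs) (true  ∷ ys) e =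
  trans (+-suc _ _) (cong suc (distOutside≡0⇒dist+dist≡weight h xs ys e))
distOutside≡0⇒dist+dist≡weight (true  ∷ h) (false ∷ xs) (true  ∷ ys) e = cong suc (distOutside≡0⇒dist+dist≡weight h xs ys e)
distOutside≡0⇒dist+dist≡weight (true  ∷ h) (true  ∷ xs) (false ∷ ys) e = cong suc (distOutside≡0⇒dist+dist≡weight h xs ys e)

stepOutside : ∀ {n} → Vec Bool n → Vec Bool n → Vec Bool n → Vec Bool n
stepOutside []          []           []           = []
stepOutside (true  ∷ h) (x     ∷ xs) (_     ∷ ys) = x ∷ stepOutside h xs ys
stepOutside (false ∷ h) (false ∷ xs) (false ∷ ys) = false ∷ stepOutside h xs ys
stepOutside (false ∷ h) (true  ∷ xs) (true  ∷ ys) = true ∷ stepOutside h xs ys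
stepOutside (false ∷ h) (false ∷ xs) (true  ∷ _)  = true ∷ xs
stepOutside (false ∷ h) (true  ∷ xs) (false ∷ _)  = false ∷ xs

stepOutside-adjacent : ∀ {n} (h z s : Vec Bool n) →
                       0 < distOutside h z s → dist z (stepOutside h z s) ≡ 1
stepOutside-adjacent []          []           []           ()
stepOutside-adjacent (true  ∷ h) (false ∷ xs) (_     ∷ ys) e = stepOutside-adjacent h xs ys e
stepOutside-adjacent (true  ∷ h) (true  ∷ xs) (_     ∷ ys) e = stepOutside-adjacent h xs ys e
stepOutside-adjacent (false ∷ h) (false ∷ xs) (false ∷ ys) e = stepOutside-adjacent h xs ys e
stepOutside-adjacent (false ∷ h) (true  ∷ xs) (true  ∷ ys) e = stepOutside-adjacent h xs ys e
stepOutside-adjacent (false ∷ h) (false ∷ xs) (true  ∷ _)  _ = cong suc (dist-self xs)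
stepOutside-adjacent (false ∷ h) (true  ∷ xs) (false ∷ _)  _ = cong suc (dist-self xs)

stepOutside-closer : ∀ {n} (h z s : Vec Bool n) →
                     0 < distOutside h z s → suc (dist (stepOutside h z s) s) ≡ dist z s
stepOutside-closer []          []           []           ()
stepOutside-closer (true  ∷ h) (false ∷ xs) (false ∷ ys) e = stepOutside-closer h xs ys e
stepOutside-closer (true  ∷ h) (false ∷ xs) (true  ∷ ys) e = cong suc (stepOutside-closer h xs ys e)
stepOutside-closer (true  ∷ h) (true  ∷ xs) (false ∷ ys) e = cong suc (stepOutside-closer h xs ys e)
stepOutside-closer (true  ∷ h) (true  ∷ xs) (true  ∷ ys) e = stepOutside-closer h xs ys e
stepOutside-closer (false ∷ h) (false ∷ xs) (false ∷ ys) e = stepOutside-closer h xs ys e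
stepOutside-closer (false ∷ h) (true  ∷ xs) (true  ∷ ys) e = stepOutside-closer h xs ys e
stepOutside-closer (false ∷ h) (false ∷ xs) (true  ∷ _)  _ = refl
stepOutside-closer (false ∷ h) (true  ∷ xs) (false ∷ _)  _ = refl

stepOutside-distOutside : ∀ {n} (h z s : Vec Bool n) → 0 < distOutside h z s →
                          suc (distOutside h (stepOutside h z s) s) ≡ distOutside h z s
stepOutside-distOutside []          []           []           ()
stepOutside-distOutside (true  ∷ h) (_     ∷ xs) (_     ∷ ys) e = stepOutside-distOutside h xs ys e
stepOutside-distOutside (false ∷ h) (false ∷ xs) (false ∷ ys) e = stepOutside-distOutside h xs ys e
stepOutside-distOutside (false ∷ h) (true  ∷ xs) (true  ∷ ys) e = stepOutside-distOutside h xs ys e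
stepOutside-distOutside (false ∷ h) (false ∷ xs) (true  ∷ _)  _ = refl
stepOutside-distOutside (false ∷ h) (true  ∷ xs) (false ∷ _)  _ = refl

stepOutside-⊕ : ∀ {n} (h z s : Vec Bool n) → stepOutside h (z ⊕ h) s ≡ stepOutside h z s ⊕ h
stepOutside-⊕ []          []           []           = refl
stepOutside-⊕ (true  ∷ h) (x     ∷ xs) (_     ∷ ys) = cong ((x xor true) ∷_) (stepOutside-⊕ h xs ys)
stepOutside-⊕ (false ∷ h) (false ∷ xs) (false ∷ ys) = cong (false ∷_) (stepOutside-⊕ h xs ys)
stepOutside-⊕ (false ∷ h) (true  ∷ xs) (true  ∷ ys) = cong (true ∷_) (stepOutside-⊕ h xs ys)
stepOutside-⊕ (false ∷ h) (false ∷ xs) (true  ∷ _)  = refl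
stepOutside-⊕ (false ∷ h) (true  ∷ xs) (false ∷ _)  = refl

stepToward : ∀ {n} → Vec Bool n → Vec Bool n → Vec Bool n
stepToward {n} = stepOutside (replicate n false)

module _ {n} (z s : Vec Bool n) (z≢s : 0 < dist z s) where

  private
    outside>0 : 0 < distOutside (replicate n false) z s
    outside>0 = subst (0 <_) (sym (distOutside-none z s)) z≢s

  stepToward-adjacent : dist z (stepToward z s) ≡ 1
  stepToward-adjacent = stepOutside-adjacent (replicate n false) z s outside>0

  stepToward-closer : suc (dist (stepToward z s) s) ≡ dist z s
  stepToward-closer = stepOutside-closer (replicate n false) z s outside>0

adjacent⇒dist≡1 : ∀ {n} (u v : Vec Bool n) → Adj (Q n) u v → dist u v ≡ 1
adjacent⇒dist≡1 u v a = trans (sym (hamming≡dist u v)) a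

dist≡1⇒adjacent : ∀ {n} (u v : Vec Bool n) → dist u v ≡ 1 → Adj (Q n) u v
dist≡1⇒adjacent u v e = trans (hamming≡dist u v) e

walkOfLength : ∀ {n} d (u v : Vec Bool n) → dist u v ≡ d → Walk (Q n) u v d
walkOfLength {n} zero    u v e = subst (λ w → Walk (Q n) u w 0) (dist≡0⇒≡ e) here
walkOfLength {n} (suc d) u v e =
  there (dist≡1⇒adjacent u _ (stepToward-adjacent u v u≢v))
        (walkOfLength d (stepToward u v) v (suc-injective (trans (stepToward-closer u v u≢v) e)))
  where
  u≢v : 0 < dist u v
  u≢v = subst (0 <_) (sym e) z<s

dist≤length : ∀ {n} {u v : Vec Bool n} {m} → Walk (Q n) u v m → dist u v ≤ m
dist≤length {u = u} here = ≤-reflexive (dist-self u)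
dist≤length {u = u} {v} (there {v = w} a W) =
  ≤-trans (dist-triangle u w v) (+-mono-≤ (≤-reflexive (adjacent⇒dist≡1 u w a)) (dist≤length W))

dist-Dist : ∀ {n} (u v : Vec Bool n) → Dist (Q n) u v (dist u v)
dist-Dist u v = walkOfLength _ u v refl , λ _ → dist≤length

Dist⇒≡dist : ∀ {n} {u v : Vec Bool n} {d} → Dist (Q n) u v d → d ≡ dist u v
Dist⇒≡dist {u = u} {v} (W , shortest) = ≤-antisym (shortest _ (walkOfLength _ u v refl)) (dist≤length W)

closer⇒< : ∀ {n} {w z s : Vec Bool n} → Closer (Q n) w z s → dist w s < dist z s
closer⇒< (_ , _ , Dw , Dz , lt) = subst₂ _<_ (Dist⇒≡dist Dw) (Dist⇒≡dist Dz) lt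

legalStep : ∀ {n} {z z′ s : Vec Bool n} →
            dist z z′ ≡ 1 → suc (dist z′ s) ≡ dist z s → Adj (Q n) z z′ × Closer (Q n) z′ z s
legalStep {z = z} {z′} {s} a c =
  dist≡1⇒adjacent z z′ a , (dist z′ s , dist z s , dist-Dist z′ s , dist-Dist z s , ≤-reflexive c)

legalStep⇒closer : ∀ {n} {z z′ s : Vec Bool n} →
                   Adj (Q n) z z′ × Closer (Q n) z′ z s → dist z s ≡ suc (dist z′ s)
legalStep⇒closer {z = z} {z′} {s} (a , c) = ≤-antisym
  (≤-trans (dist-triangle z z′ s) (≤-reflexive (cong (_+ dist z′ s) (adjacent⇒dist≡1 z z′ a))))
  (closer⇒< c)

survivorMove-dist≤1 : ∀ {n} {s s′ : Vec Bool n} → s′ ≡ s ⊎ Adj (Q n) s s′ → dist s s′ ≤ 1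
survivorMove-dist≤1 {s = s} (inj₁ refl) = ≤-trans (≤-reflexive (dist-self s)) z≤n
survivorMove-dist≤1 {s = s} {s′} (inj₂ adj) = ≤-reflexive (adjacent⇒dist≡1 s s′ adj)

∑ : ∀ {k} → (Fin k → ℕ) → ℕ
∑ {zero}  f = 0
∑ {suc k} f = f F.zero + ∑ (f ∘ F.suc)

∑-cong : ∀ {k} {f g : Fin k → ℕ} → (∀ i → f i ≡ g i) → ∑ f ≡ ∑ g
∑-cong {zero}  e = refl
∑-cong {suc k} e = cong₂ _+_ (e F.zero) (∑-cong (e ∘ F.suc))

∑-mono-≤ : ∀ {k} {f g : Fin k → ℕ} → (∀ i → f i ≤ g i) → ∑ f ≤ ∑ g
∑-mono-≤ {zero}  le = z≤n
∑-mono-≤ {suc k} le = +-mono-≤ (le F.zero) (∑-mono-≤ (le ∘ F.suc))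

∑-distrib-+ : ∀ {k} (f g : Fin k → ℕ) → ∑ (λ i → f i + g i) ≡ ∑ f + ∑ g
∑-distrib-+ {zero}  f g = refl
∑-distrib-+ {suc k} f g = trans (cong (f F.zero + g F.zero +_) (∑-distrib-+ (f ∘ F.suc) (g ∘ F.suc)))
                                (interchange (f F.zero) (g F.zero) (∑ (f ∘ F.suc)) (∑ (g ∘ F.suc)))

∑-const : ∀ {k} c → ∑ {k} (λ _ → c) ≡ k * c
∑-const {zero}  c = refl
∑-const {suc k} c = cong (c +_) (∑-const {k} c)

∑-suc : ∀ {k} (f : Fin k → ℕ) → ∑ (suc ∘ f) ≡ k + ∑ f
∑-suc {k} f = trans (∑-distrib-+ (λ _ → 1) f) (cong (_+ ∑ f) (trans (∑-const {k} 1) (*-identityʳ k)))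

∑-*ˡ : ∀ {k} c (f : Fin k → ℕ) → ∑ (λ i → c * f i) ≡ c * ∑ f
∑-*ˡ {zero}  c f = sym (*-zeroʳ c)
∑-*ˡ {suc k} c f = trans (cong (c * f F.zero +_) (∑-*ˡ c (f ∘ F.suc))) (sym (*-distribˡ-+ c (f F.zero) _))

∑-bits-with-zero< : ∀ {k} (f : Fin k → ℕ) → (∀ i → f i ≤ 1) → Σ (Fin k) (λ i → f i ≡ 0) → ∑ f < k
∑-bits-with-zero< {suc k} f ≤1 (F.zero , f0≡0) rewrite f0≡0 =
  s≤s (≤-trans (∑-mono-≤ (≤1 ∘ F.suc)) (≤-reflexive (trans (∑-const {k} 1) (*-identityʳ k))))
∑-bits-with-zero< {suc k} f ≤1 (F.suc i , fi≡0) =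
  ≤-trans (≤-reflexive (sym (+-suc (f F.zero) _)))
          (+-mono-≤ (≤1 F.zero) (∑-bits-with-zero< (f ∘ F.suc) (≤1 ∘ F.suc) (i , fi≡0)))

∑≡0⇒≡0 : ∀ {k} (f : Fin k → ℕ) → ∑ f ≡ 0 → ∀ i → f i ≡ 0
∑≡0⇒≡0 {suc k} f e F.zero    = m+n≡0⇒m≡0 (f F.zero) e
∑≡0⇒≡0 {suc k} f e (F.suc i) = ∑≡0⇒≡0 (f ∘ F.suc) (m+n≡0⇒n≡0 (f F.zero) e) i

-- The zombies' strategy

approach : ∀ {n k} → Vec (Vec Bool n) k → Vec Bool n → Vec (Vec Bool n) k
approach Z s = map (λ z → stepToward z s) Z

approach-legal : ∀ {n k} (Z : Vec (Vec Bool n) k) s →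
                 (∀ i → 0 < dist (lookup Z i) s) → ZMove (Q n) Z (approach Z s) s
approach-legal Z s uncaught i rewrite lookup-map i (λ z → stepToward z s) Z =
  legalStep (stepToward-adjacent (lookup Z i) s (uncaught i)) (stepToward-closer (lookup Z i) s (uncaught i))

approach-catches : ∀ {n k} (Z : Vec (Vec Bool n) k) s i → dist (lookup Z i) s ≡ 1 → Caught (Q n) (approach Z s) s
approach-catches Z s i d≡1 = i , trans (lookup-map i (λ z → stepToward z s) Z) (dist≡0⇒≡ d′≡0)
  where
  d′≡0 : dist (stepToward (lookup Z i) s) s ≡ 0
  d′≡0 = suc-injective (trans (stepToward-closer (lookup Z i) s (≤-reflexive (sym d≡1))) d≡1)

Covers : ∀ {n k} → Vec (Vec Bool n) k → Set
Covers {n} {k} H = ∀ (t : Fin n) → Σ (Fin k) λ i → lookup (lookup H i) t ≡ true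

Paired : ∀ {n k} → Vec (Vec Bool n) k → Vec (Vec Bool n) k → Set
Paired {n} {k} H Z = ∀ i →
  weight (lookup H i) ≤ 1 ⊎
  (weight (lookup H i) ≤ 3 ×
   Σ (Fin k) λ j → lookup H j ≡ lookup H i × lookup Z j ≡ lookup Z i ⊕ lookup H i)

module ZombieStrategy {n k} (H : Vec (Vec Bool n) k) (covers : Covers H) (k≥1 : 1 ≤ k) where

  potential : Vec (Vec Bool n) k → Vec Bool n → ℕ
  potential Z s = ∑ λ i → distOutside (lookup H i) (lookup Z i) s

  distOutside>0 : ∀ Z s → Paired H Z → (∀ i → 2 ≤ dist (lookup Z i) s) →
                  ∀ i → 0 < distOutside (lookup H i) (lookup Z i) s
  distOutside>0 Z s paired far i with paired i
  ... | inj₁ |h|≤1 = n≢0⇒n>0 λ e →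
    <⇒≱ (far i) (≤-trans (m≤m+n _ _)
                         (≤-trans (≤-reflexive (distOutside≡0⇒dist+dist≡weight (lookup H i) (lookup Z i) s e)) |h|≤1))
  ... | inj₂ (|h|≤3 , j , _ , Zj≡) = n≢0⇒n>0 λ e →
    <⇒≱ (+-mono-≤ (far i) (subst (λ w → 2 ≤ dist w s) Zj≡ (far j)))
        (≤-trans (≤-reflexive (distOutside≡0⇒dist+dist≡weight (lookup H i) (lookup Z i) s e)) |h|≤3)

  advance : Vec (Vec Bool n) k → Vec Bool n → Vec (Vec Bool n) k
  advance Z s = zipWith (λ h z → stepOutside h z s) H Z

  lookup-advance : ∀ Z s i → lookup (advance Z s) i ≡ stepOutside (lookup H i) (lookup Z i) s
  lookup-advance Z s i = lookup-zipWith _ i H Z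

  advance-legal : ∀ Z s → (∀ i → 0 < distOutside (lookup H i) (lookup Z i) s) → ZMove (Q n) Z (advance Z s) s
  advance-legal Z s pos i rewrite lookup-advance Z s i =
    legalStep (stepOutside-adjacent (lookup H i) (lookup Z i) s (pos i))
              (stepOutside-closer (lookup H i) (lookup Z i) s (pos i))

  advance-paired : ∀ Z s → Paired H Z → Paired H (advance Z s)
  advance-paired Z s paired i with paired i
  ... | inj₁ |h|≤1 = inj₁ |h|≤1
  ... | inj₂ (|h|≤3 , j , Hj≡ , Zj≡) = inj₂ (|h|≤3 , j , Hj≡ , (begin
    lookup (advance Z s) j                              ≡⟨ lookup-advance Z s j ⟩
    stepOutside (lookup H j) (lookup Z j) s             ≡⟨ cong₂ (λ h z → stepOutside h z s) Hj≡ Zj≡ ⟩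
    stepOutside (lookup H i) (lookup Z i ⊕ lookup H i) s ≡⟨ stepOutside-⊕ (lookup H i) (lookup Z i) s ⟩
    stepOutside (lookup H i) (lookup Z i) s ⊕ lookup H i ≡⟨ cong (_⊕ lookup H i) (lookup-advance Z s i) ⟨
    lookup (advance Z s) i ⊕ lookup H i                 ∎))
    where open ≡-Reasoning

  advance-potential : ∀ Z s → (∀ i → 0 < distOutside (lookup H i) (lookup Z i) s) →
                      potential Z s ≡ k + potential (advance Z s) s
  advance-potential Z s pos = trans (∑-cong drop) (∑-suc {k} λ i → distOutside (lookup H i) (lookup (advance Z s) i) s)
    where
    drop : ∀ i → distOutside (lookup H i) (lookup Z i) s ≡ suc (distOutside (lookup H i) (lookup (advance Z s) i) s)
    drop i = sym (trans (cong (λ w → suc (distOutside (lookup H i) w s)) (lookup-advance Z s i))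
                        (stepOutside-distOutside (lookup H i) (lookup Z i) s (pos i)))

  blindToMove : ∀ {s s′} → s′ ≡ s ⊎ Adj (Q n) s s′ → Σ (Fin k) λ i → distOutside (lookup H i) s s′ ≡ 0
  blindToMove {s} (inj₁ refl) = F.fromℕ< k≥1 , distOutside-self (lookup H (F.fromℕ< k≥1)) s
  blindToMove {s} {s′} (inj₂ adj) with dist≡1⇒flip s s′ (adjacent⇒dist≡1 s s′ adj)
  ... | t , refl = let i , t∈Hi = covers t in i , distOutside-flip (lookup H i) s t t∈Hi

  survivorMove-potential : ∀ Z {s s′} → s′ ≡ s ⊎ Adj (Q n) s s′ → potential Z s′ < k + potential Z s
  survivorMove-potential Z {s} {s′} step = begin-strict
    potential Z s′
      ≤⟨ ∑-mono-≤ (λ i → distOutside-triangle (lookup H i) (lookup Z i) s s′) ⟩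
    ∑ (λ i → distOutside (lookup H i) (lookup Z i) s + distOutside (lookup H i) s s′)
      ≡⟨ ∑-distrib-+ (λ i → distOutside (lookup H i) (lookup Z i) s) (λ i → distOutside (lookup H i) s s′) ⟩
    potential Z s + ∑ (λ i → distOutside (lookup H i) s s′)
      <⟨ +-monoʳ-< (potential Z s) (∑-bits-with-zero< _ ≤1 (blindToMove step)) ⟩
    potential Z s + k
      ≡⟨ +-comm (potential Z s) k ⟩
    k + potential Z s
      ∎
    where
    open ≤-Reasoning
    ≤1 : ∀ i → distOutside (lookup H i) s s′ ≤ 1
    ≤1 i = ≤-trans (distOutside≤dist (lookup H i) s s′) (survivorMove-dist≤1 step)

  zombiesWin : ∀ m Z s → Paired H Z → potential Z s < m → ZWin (Q n) Z s
  zombiesWin zero    Z s _ ()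
  zombiesWin (suc m) Z s paired bound with any? (λ i → dist (lookup Z i) s ≟ 0)
  ... | yes (i , d≡0) = caught (i , dist≡0⇒≡ d≡0)
  ... | no uncaught with any? (λ i → dist (lookup Z i) s ≟ 1)
  ... | yes (i , d≡1) = move (approach Z s) (approach-legal Z s (λ i → n≢0⇒n>0 (λ e → uncaught (i , e))))
                             (inj₁ (approach-catches Z s i d≡1))
  ... | no unadjacent = move (advance Z s) (advance-legal Z s pos)
                             (inj₂ λ s′ step → zombiesWin m (advance Z s) s′ (advance-paired Z s paired) (decreases step))
    where
    far : ∀ i → 2 ≤ dist (lookup Z i) s
    far i with dist (lookup Z i) s in e
    ... | zero        = contradiction (i , e) uncaught
    ... | suc zero    = contradiction (i , e) unadjacent
    ... | suc (suc _) = s≤s (s≤s z≤n)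
    pos : ∀ i → 0 < distOutside (lookup H i) (lookup Z i) s
    pos = distOutside>0 Z s paired far
    decreases : ∀ {s′} → s′ ≡ s ⊎ Adj (Q n) s s′ → potential (advance Z s) s′ < m
    decreases step = ≤-trans (survivorMove-potential (advance Z s) step)
                             (≤-trans (≤-reflexive (sym (advance-potential Z s pos))) (≤-pred bound))

  pairedPlacementWins : ∀ Z → Paired H Z → ZombiesWin (Q n) k
  pairedPlacementWins Z paired = Z , λ s → zombiesWin _ Z s paired ≤-refl

-- Blocks of three coordinates, and a leftover pair, are each the blind set of two antipodal zombies;
-- a single leftover coordinate is the blind set of one zombie.
zombieCount : ℕ → ℕ
zombieCount 0                   = 0
zombieCount 1                   = 1
zombieCount 2                   = 2
zombieCount (suc (suc (suc n))) = suc (suc (zombieCount n))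

T³ F³ : ∀ {n} → Vec Bool n → Vec Bool (3 + n)
T³ v = true  ∷ true  ∷ true  ∷ v
F³ v = false ∷ false ∷ false ∷ v

blindSets : ∀ n → Vec (Vec Bool n) (zombieCount n)
blindSets 0                   = []
blindSets 1                   = (true ∷ []) ∷ []
blindSets 2                   = (true ∷ true ∷ []) ∷ (true ∷ true ∷ []) ∷ []
blindSets (suc (suc (suc n))) = T³ (replicate n false) ∷ T³ (replicate n false) ∷ map F³ (blindSets n)

placement : ∀ n → Vec (Vec Bool n) (zombieCount n)
placement 0                   = []
placement 1                   = (false ∷ []) ∷ []
placement 2                   = (false ∷ false ∷ []) ∷ (true ∷ true ∷ []) ∷ []
placement (suc (suc (suc n))) = F³ (replicate n false) ∷ T³ (replicate n false) ∷ map F³ (placement n)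

blindSets-cover : ∀ n → Covers (blindSets n)
blindSets-cover 1 F.zero                     = F.zero , refl
blindSets-cover 2 F.zero                     = F.zero , refl
blindSets-cover 2 (F.suc F.zero)             = F.zero , refl
blindSets-cover (suc (suc (suc n))) F.zero                     = F.zero , refl
blindSets-cover (suc (suc (suc n))) (F.suc F.zero)             = F.zero , refl
blindSets-cover (suc (suc (suc n))) (F.suc (F.suc F.zero))     = F.zero , refl
blindSets-cover (suc (suc (suc n))) (F.suc (F.suc (F.suc t))) =
  let i , t∈Hi = blindSets-cover n t
  in F.suc (F.suc i) , trans (cong (λ h → lookup h (F.suc (F.suc (F.suc t)))) (lookup-map i F³ (blindSets n))) t∈Hi

placement-paired : ∀ n → Paired (blindSets n) (placement n)
placement-paired 1 F.zero         = inj₁ ≤-refl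
placement-paired 2 F.zero         = inj₂ (s≤s (s≤s z≤n) , F.suc F.zero , refl , refl)
placement-paired 2 (F.suc F.zero) = inj₂ (s≤s (s≤s z≤n) , F.zero , refl , refl)
placement-paired (suc (suc (suc n))) F.zero =
  inj₂ (≤-reflexive (cong (3 +_) (weight-replicate-false n)) , F.suc F.zero , refl ,
        cong T³ (sym (⊕-self (replicate n false))))
placement-paired (suc (suc (suc n))) (F.suc F.zero) =
  inj₂ (≤-reflexive (cong (3 +_) (weight-replicate-false n)) , F.zero , refl ,
        cong F³ (sym (⊕-self (replicate n false))))
placement-paired (suc (suc (suc n))) (F.suc (F.suc i))
  rewrite lookup-map i F³ (blindSets n) | lookup-map i F³ (placement n) with placement-paired n i
... | inj₁ |h|≤1 = inj₁ |h|≤1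
... | inj₂ (|h|≤3 , j , Hj≡ , Zj≡) =
  inj₂ (|h|≤3 , F.suc (F.suc j) , trans (lookup-map j F³ (blindSets n)) (cong F³ Hj≡) ,
                                  trans (lookup-map j F³ (placement n)) (cong F³ Zj≡))

ceil3-+6 : ∀ m → ceil3 (6 + m) ≡ 2 + ceil3 m
ceil3-+6 m = trans (m/n≡1+[m∸n]/n {6 + m + 2} {3} (s≤s (s≤s (s≤s z≤n))))
                   (cong suc (m/n≡1+[m∸n]/n {3 + m + 2} {3} (s≤s (s≤s (s≤s z≤n)))))

zombieCount≡ceil3 : ∀ n → zombieCount n ≡ ceil3 (2 * n)
zombieCount≡ceil3 0 = refl
zombieCount≡ceil3 1 = refl
zombieCount≡ceil3 2 = refl
zombieCount≡ceil3 (suc (suc (suc n))) = begin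
  2 + zombieCount n      ≡⟨ cong (2 +_) (zombieCount≡ceil3 n) ⟩
  2 + ceil3 (2 * n)      ≡⟨ ceil3-+6 (2 * n) ⟨
  ceil3 (6 + 2 * n)      ≡⟨ cong ceil3 (*-distribˡ-+ 2 3 n) ⟨
  ceil3 (2 * (3 + n))    ∎
  where open ≡-Reasoning

zombiesWin-hypercube : ∀ n → 1 ≤ n → ZombiesWin (Q n) (ceil3 (2 * n))
zombiesWin-hypercube n@(suc n-1) _ = subst (ZombiesWin (Q n)) (zombieCount≡ceil3 n)
  (ZombieStrategy.pairedPlacementWins (blindSets n) (blindSets-cover n) (k≥1 n-1) (placement n) (placement-paired n))
  where
  k≥1 : ∀ m → 1 ≤ zombieCount (suc m)
  k≥1 0             = s≤s z≤n
  k≥1 1             = s≤s z≤n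
  k≥1 (suc (suc _)) = s≤s z≤n

isOdd : ℕ → Bool
isOdd zero    = false
isOdd (suc m) = not (isOdd m)

isOdd-bit+ : ∀ c m → isOdd (bit c + m) ≡ c xor isOdd m
isOdd-bit+ false m = refl
isOdd-bit+ true  m = refl

parity : ∀ {n} → Vec Bool n → Bool
parity []       = false
parity (x ∷ xs) = x xor parity xs

isOdd-dist : ∀ {n} (z s : Vec Bool n) → isOdd (dist z s) ≡ parity z xor parity s
isOdd-dist []       []       = refl
isOdd-dist (x ∷ z) (y ∷ s) = begin
  isOdd (bit (x xor y) + dist z s)          ≡⟨ isOdd-bit+ (x xor y) (dist z s) ⟩
  (x xor y) xor isOdd (dist z s)            ≡⟨ cong ((x xor y) xor_) (isOdd-dist z s) ⟩
  (x xor y) xor (parity z xor parity s)     ≡⟨ xor-interchange x y (parity z) (parity s) ⟩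
  (x xor parity z) xor (y xor parity s)     ∎
  where open ≡-Reasoning

parity-flip : ∀ {n} (s : Vec Bool n) t → parity (s [ t ]%= not) ≡ not (parity s)
parity-flip (x ∷ s) F.zero    = sym (not-distribˡ-xor x (parity s))
parity-flip (x ∷ s) (F.suc t) = trans (cong (x xor_) (parity-flip s t)) (sym (not-distribʳ-xor x (parity s)))

isOdd-dist-flip : ∀ {n} (z s : Vec Bool n) t → isOdd (dist z (s [ t ]%= not)) ≡ not (isOdd (dist z s))
isOdd-dist-flip z s t = begin
  isOdd (dist z (s [ t ]%= not))          ≡⟨ isOdd-dist z (s [ t ]%= not) ⟩
  parity z xor parity (s [ t ]%= not)     ≡⟨ cong (parity z xor_) (parity-flip s t) ⟩
  parity z xor not (parity s)             ≡⟨ not-distribʳ-xor (parity z) (parity s) ⟨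
  not (parity z xor parity s)             ≡⟨ cong not (isOdd-dist z s) ⟨
  not (isOdd (dist z s))                  ∎
  where open ≡-Reasoning

-- The survivor's strategy

flip-keeps-far : ∀ {n} (z s : Vec Bool n) t → 1 ≤ dist z s →
                 (dist z s ≤ 2 → lookup z t ≡ lookup s t) → 2 ≤ dist z (s [ t ]%= not)
flip-keeps-far z s t d≥1 agree with dist z s ≤? 2
... | yes d≤2 = subst (2 ≤_) (sym (dist-flip-agreeing z s t (agree d≤2))) (s≤s d≥1)
... | no  d≰2 = ≤-pred (begin
  3                                        ≤⟨ ≰⇒> d≰2 ⟩
  dist z s                                 ≤⟨ dist-triangle z (s [ t ]%= not) s ⟩
  dist z (s [ t ]%= not) + dist (s [ t ]%= not) s ≡⟨ cong (dist z (s [ t ]%= not) +_) (trans (dist-sym _ s) (dist-flip s t)) ⟩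
  dist z (s [ t ]%= not) + 1               ≡⟨ +-comm _ 1 ⟩
  suc (dist z (s [ t ]%= not))             ∎)
  where open ≤-Reasoning

freeCoordinate : ∀ {n k} (v : Fin k → Vec Bool n) → ∑ (weight ∘ v) < n →
                 Σ (Fin n) λ t → ∀ i → lookup (v i) t ≡ false
freeCoordinate {suc n} v bound with ∑ (bit ∘ head ∘ v) ≟ 0
... | yes heads≡0 = F.zero , λ i → head-free (v i) (∑≡0⇒≡0 (bit ∘ head ∘ v) heads≡0 i)
  where
  head-free : ∀ (u : Vec Bool (suc n)) → bit (head u) ≡ 0 → lookup u F.zero ≡ false
  head-free (false ∷ _) _ = refl
... | no heads≢0 = let t , free = freeCoordinate (tail ∘ v) tails-bound in F.suc t , λ i → lookup-suc (v i) (free i)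
  where
  lookup-suc : ∀ (u : Vec Bool (suc n)) {t} → lookup (tail u) t ≡ false → lookup u (F.suc t) ≡ false
  lookup-suc (_ ∷ _) e = e
  weight-∷ : ∀ (u : Vec Bool (suc n)) → weight u ≡ bit (head u) + weight (tail u)
  weight-∷ (_ ∷ _) = refl
  tails-bound : ∑ (weight ∘ tail ∘ v) < n
  tails-bound = +-cancelˡ-< 1 _ n (begin-strict
    1 + ∑ (weight ∘ tail ∘ v)                       ≤⟨ +-monoˡ-≤ _ (n≢0⇒n>0 heads≢0) ⟩
    ∑ (bit ∘ head ∘ v) + ∑ (weight ∘ tail ∘ v)      ≡⟨ ∑-distrib-+ (bit ∘ head ∘ v) (weight ∘ tail ∘ v) ⟨
    ∑ (λ i → bit (head (v i)) + weight (tail (v i))) ≡⟨ ∑-cong (weight-∷ ∘ v) ⟨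
    ∑ (weight ∘ v)                                  <⟨ bound ⟩
    suc n                                           ∎)
    where open ≤-Reasoning

keepIfAtMost2 : ∀ {n} → ℕ → Vec Bool n → Vec Bool n
keepIfAtMost2 0                   v = v
keepIfAtMost2 1                   v = v
keepIfAtMost2 2                   v = v
keepIfAtMost2 (suc (suc (suc _))) v = replicate _ false

threat : ∀ {n} → Vec Bool n → Vec Bool n → Vec Bool n
threat z s = keepIfAtMost2 (dist z s) (z ⊕ s)

weight-threat : ∀ {n} (z s : Vec Bool n) → weight (threat z s) ≤ 1 + bit (not (isOdd (dist z s)))
weight-threat z s = bound (dist z s) (z ⊕ s) refl
  where
  bound : ∀ {n} m (v : Vec Bool n) → weight v ≡ m → weight (keepIfAtMost2 m v) ≤ 1 + bit (not (isOdd m))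
  bound 0                   v e = ≤-trans (≤-reflexive e) z≤n
  bound 1                   v e = ≤-reflexive e
  bound 2                   v e = ≤-reflexive e
  bound {n} (suc (suc (suc _))) v e = ≤-trans (≤-reflexive (weight-replicate-false n)) z≤n

threat-free : ∀ {n} (z s : Vec Bool n) t → lookup (threat z s) t ≡ false → dist z s ≤ 2 → lookup z t ≡ lookup s t
threat-free z s t free d≤2 = xor≡false⇒≡ (lookup z t) (lookup s t)
  (trans (sym (lookup-zipWith _xor_ t z s)) (subst (λ v → lookup v t ≡ false) (kept (dist z s) d≤2) free))
  where
  kept : ∀ m → m ≤ 2 → keepIfAtMost2 m (z ⊕ s) ≡ z ⊕ s
  kept 0 _ = refl
  kept 1 _ = refl
  kept 2 _ = refl
  kept (suc (suc (suc _))) (s≤s (s≤s ()))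
  xor≡false⇒≡ : ∀ x y → x xor y ≡ false → x ≡ y
  xor≡false⇒≡ false false _ = refl
  xor≡false⇒≡ true  true  _ = refl

module SurvivorStrategy {n k : ℕ} where

  oddCount : Vec (Vec Bool n) k → Vec Bool n → ℕ
  oddCount Z s = ∑ λ i → bit (isOdd (dist (lookup Z i) s))

  Safe : Vec (Vec Bool n) k → Vec Bool n → Set
  Safe Z s = (∀ i → 2 ≤ dist (lookup Z i) s) × oddCount Z s + k < n

  escape : ∀ Z Z′ s → Safe Z s → ZMove (Q n) Z Z′ s → Σ (Vec Bool n) λ s′ → Adj (Q n) s s′ × Safe Z′ s′
  escape Z Z′ s (far , bound) zmove = s′ , dist≡1⇒adjacent s s′ (dist-flip s t) , far′ , bound′
    where
    closer : ∀ i → dist (lookup Z i) s ≡ suc (dist (lookup Z′ i) s)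
    closer i = legalStep⇒closer (zmove i)
    threats< : ∑ (λ i → weight (threat (lookup Z′ i) s)) < n
    threats< = begin-strict
      ∑ (λ i → weight (threat (lookup Z′ i) s))               ≤⟨ ∑-mono-≤ (λ i → weight-threat (lookup Z′ i) s) ⟩
      ∑ (λ i → suc (bit (isOdd (suc (dist (lookup Z′ i) s))))) ≡⟨ ∑-cong (λ i → cong (suc ∘ bit ∘ isOdd) (closer i)) ⟨
      ∑ (λ i → suc (bit (isOdd (dist (lookup Z i) s))))        ≡⟨ ∑-suc (λ i → bit (isOdd (dist (lookup Z i) s))) ⟩
      k + oddCount Z s                                         ≡⟨ +-comm k (oddCount Z s) ⟩
      oddCount Z s + k                                         <⟨ bound ⟩
      n                                                        ∎
      where open ≤-Reasoning
    free : Σ (Fin n) λ t → ∀ i → lookup (threat (lookup Z′ i) s) t ≡ false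
    free = freeCoordinate (λ i → threat (lookup Z′ i) s) threats<
    t : Fin n
    t = proj₁ free
    s′ : Vec Bool n
    s′ = s [ t ]%= not
    far′ : ∀ i → 2 ≤ dist (lookup Z′ i) s′
    far′ i = flip-keeps-far (lookup Z′ i) s t (≤-pred (subst (2 ≤_) (closer i) (far i)))
                            (threat-free (lookup Z′ i) s t (proj₂ free i))
    parity-kept : ∀ i → isOdd (dist (lookup Z i) s) ≡ isOdd (dist (lookup Z′ i) s′)
    parity-kept i = trans (cong isOdd (closer i)) (sym (isOdd-dist-flip (lookup Z′ i) s t))
    bound′ : oddCount Z′ s′ + k < n
    bound′ = subst (λ c → c + k < n) (∑-cong (cong bit ∘ parity-kept)) bound

  evade : ∀ Z s → Safe Z s → ¬ ZWin (Q n) Z s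
  evade Z s (far , _) (caught (i , Zi≡s)) =
    <⇒≱ (far i) (≤-trans (≤-reflexive (≡⇒dist≡0 Zi≡s)) z≤n)
  evade Z s (far , _) (move Z′ zmove (inj₁ (i , Z′i≡s))) =
    <⇒≱ (far i) (≤-reflexive (trans (legalStep⇒closer (zmove i)) (cong suc (≡⇒dist≡0 Z′i≡s))))
  evade Z s safe (move Z′ zmove (inj₂ continue)) with escape Z Z′ s safe zmove
  ... | s′ , adj , safe′ = evade Z′ s′ safe′ (continue s′ (inj₂ adj))

-- A safe starting vertex

-- count n p b is the number of vertices s of parity p with b s ≡ true.
count : ∀ n → Bool → (Vec Bool n → Bool) → ℕ
count zero    false b = bit (b [])
count zero    true  b = 0
count (suc n) p     b = count n p (b ∘ (false ∷_)) + count n (not p) (b ∘ (true ∷_))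

count-false : ∀ n p → count n p (λ _ → false) ≡ 0
count-false zero    false = refl
count-false zero    true  = refl
count-false (suc n) p     = cong₂ _+_ (count-false n p) (count-false n (not p))

count-true : ∀ n p → count (suc n) p (λ _ → true) ≡ 2 ^ n
count-true zero    false = refl
count-true zero    true  = refl
count-true (suc n) p     = begin
  count (suc n) p (λ _ → true) + count (suc n) (not p) (λ _ → true) ≡⟨ cong₂ _+_ (count-true n p) (count-true n (not p)) ⟩
  2 ^ n + 2 ^ n                                                       ≡⟨ cong (2 ^ n +_) (+-identityʳ (2 ^ n)) ⟨
  2 ^ suc n                                                           ∎
  where open ≡-Reasoning

avoidAll : ∀ {k} n p (b : Fin k → Vec Bool n → Bool) →
           ∑ (λ i → count n p (b i)) < count n p (λ _ → true) →
           Σ (Vec Bool n) λ s → parity s ≡ p × ∀ i → b i s ≡ false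
avoidAll zero false b lt = [] , refl , λ i → bit≡0⇒false (∑≡0⇒≡0 (λ i → bit (b i [])) (n<1⇒n≡0 lt) i)
  where
  bit≡0⇒false : ∀ {x} → bit x ≡ 0 → x ≡ false
  bit≡0⇒false {false} _ = refl
avoidAll {k} (suc n) p b lt with ∑ (λ i → count n p (b i ∘ (false ∷_))) <? count n p (λ _ → true)
... | yes lt₀ = let s , par , avoid = avoidAll n p (λ i → b i ∘ (false ∷_)) lt₀ in false ∷ s , par , avoid
... | no ¬lt₀ = let s , par , avoid = avoidAll n (not p) (λ i → b i ∘ (true ∷_)) lt₁
                in true ∷ s , trans (cong not par) (not-involutive p) , avoid
  where
  L R : Fin k → ℕ
  L i = count n p (b i ∘ (false ∷_))
  R i = count n (not p) (b i ∘ (true ∷_))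
  lt₁ : ∑ R < count n (not p) (λ _ → true)
  lt₁ = +-cancelˡ-< (∑ L) (∑ R) _
          (≤-trans (subst (_< _) (∑-distrib-+ L R) lt) (+-monoˡ-≤ _ (≮⇒≥ ¬lt₀)))

count-dist<1 : ∀ {n} (z : Vec Bool n) p → count n p (λ s → dist z s <ᵇ 1) ≤ bit (not (parity z xor p))
count-dist<1 []          false = ≤-refl
count-dist<1 []          true  = z≤n
count-dist<1 {suc n} (false ∷ z) p =
  ≤-trans (+-mono-≤ (count-dist<1 z p) (≤-reflexive (count-false n (not p)))) (≤-reflexive (+-identityʳ _))
count-dist<1 {suc n} (true  ∷ z) p =
  ≤-trans (+-mono-≤ (≤-reflexive (count-false n p)) (count-dist<1 z (not p)))
          (≤-reflexive (cong (bit ∘ not) (trans (sym (not-distribʳ-xor (parity z) p)) (not-distribˡ-xor (parity z) p))))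

nearBound : ℕ → Bool → ℕ
nearBound n false = 1
nearBound n true  = n

-- Within distance 1 of z lie z itself and its n neighbours, which have the opposite parity.
count-dist<2 : ∀ {n} (z : Vec Bool n) p → count n p (λ s → dist z s <ᵇ 2) ≤ nearBound n (parity z xor p)
count-dist<2 []          false = ≤-refl
count-dist<2 []          true  = z≤n
count-dist<2 {suc n} (false ∷ z) p =
  ≤-trans (+-mono-≤ (count-dist<2 z p) (count-dist<1 z (not p))) (step (parity z) p)
  where
  step : ∀ q p → nearBound n (q xor p) + bit (not (q xor not p)) ≤ nearBound (suc n) (q xor p)
  step false false = ≤-refl
  step false true  = ≤-reflexive (+-comm n 1)
  step true  false = ≤-reflexive (+-comm n 1)
  step true  true  = ≤-refl
count-dist<2 {suc n} (true  ∷ z) p =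
  ≤-trans (+-mono-≤ (count-dist<1 z p) (count-dist<2 z (not p))) (step (parity z) p)
  where
  step : ∀ q p → bit (not (q xor p)) + nearBound n (q xor not p) ≤ nearBound (suc n) (not q xor p)
  step false false = ≤-refl
  step false true  = ≤-refl
  step true  false = ≤-refl
  step true  true  = ≤-refl

nearBound-suc : ∀ n x → nearBound (suc n) x ≡ suc (n * bit x)
nearBound-suc n false = cong suc (sym (*-zeroʳ n))
nearBound-suc n true  = cong suc (sym (*-identityʳ n))

<ᵇ2≡false⇒2≤ : ∀ d → (d <ᵇ 2) ≡ false → 2 ≤ d
<ᵇ2≡false⇒2≤ (suc (suc _)) _ = s≤s (s≤s z≤n)

oppositeCount : ∀ {k} → (Fin k → Bool) → Bool → ℕ
oppositeCount q p = ∑ λ i → bit (q i xor p)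

oppositeCount-total : ∀ {k} (q : Fin k → Bool) → oppositeCount q false + oppositeCount q true ≡ k
oppositeCount-total {k} q = begin
  oppositeCount q false + oppositeCount q true         ≡⟨ ∑-distrib-+ (λ i → bit (q i xor false)) (λ i → bit (q i xor true)) ⟨
  ∑ (λ i → bit (q i xor false) + bit (q i xor true))   ≡⟨ ∑-cong (λ i → one (q i)) ⟩
  ∑ {k} (λ _ → 1)                                      ≡⟨ ∑-const {k} 1 ⟩
  k * 1                                                ≡⟨ *-identityʳ k ⟩
  k                                                    ∎
  where
  open ≡-Reasoning
  one : ∀ x → bit (x xor false) + bit (x xor true) ≡ 1
  one false = refl
  one true  = refl

minorityParity : ∀ {k} (q : Fin k → Bool) → Σ Bool λ p → 2 * oppositeCount q p ≤ k
minorityParity {k} q with oppositeCount q false ≤? oppositeCount q true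
... | yes f≤t = false , ≤-trans (+-monoʳ-≤ (oppositeCount q false) (≤-trans (≤-reflexive (+-identityʳ _)) f≤t))
                                (≤-reflexive (oppositeCount-total q))
... | no  f≰t = true  , ≤-trans (+-monoʳ-≤ (oppositeCount q true) (≤-trans (≤-reflexive (+-identityʳ _)) (<⇒≤ (≰⇒> f≰t))))
                                (≤-reflexive (trans (+-comm (oppositeCount q true) _) (oppositeCount-total q)))

6x+6x≡6[2x] : ∀ x → 6 * x + 6 * x ≡ 6 * (2 * x)
6x+6x≡6[2x] = solve-∀

linear≤exp : ∀ j → 4 * suc j + 7 ≤ 6 * 2 ^ suc j
linear≤exp zero    = m≤m+n 11 1
linear≤exp (suc j) = begin
  4 * suc (suc j) + 7           ≡⟨ expand j ⟩
  (4 * suc j + 7) + 4           ≤⟨ +-mono-≤ (linear≤exp j) (≤-trans (m≤m+n 4 2) (*-monoʳ-≤ 6 (m^n>0 2 (suc j)))) ⟩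
  6 * 2 ^ suc j + 6 * 2 ^ suc j ≡⟨ 6x+6x≡6[2x] (2 ^ suc j) ⟩
  6 * 2 ^ suc (suc j)           ∎
  where
  open ≤-Reasoning
  expand : ∀ j → 4 * suc (suc j) + 7 ≡ (4 * suc j + 7) + 4
  expand = solve-∀

poly<exp : ∀ m → (m + 2) * (2 * m + 1) < 6 * 2 ^ m
poly<exp zero          = m≤m+n 3 3
poly<exp (suc zero)    = m≤m+n 10 2
poly<exp (suc (suc j)) = begin-strict
  (suc (suc j) + 2) * (2 * suc (suc j) + 1)          ≡⟨ expand j ⟩
  (suc j + 2) * (2 * suc j + 1) + (4 * suc j + 7)    <⟨ +-mono-<-≤ (poly<exp (suc j)) (linear≤exp j) ⟩
  6 * 2 ^ suc j + 6 * 2 ^ suc j                      ≡⟨ 6x+6x≡6[2x] (2 ^ suc j) ⟩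
  6 * 2 ^ suc (suc j)                                ∎
  where
  open ≤-Reasoning
  expand : ∀ j → (suc (suc j) + 2) * (2 * suc (suc j) + 1) ≡ (suc j + 2) * (2 * suc j + 1) + (4 * suc j + 7)
  expand = solve-∀

nearCount<exp : ∀ n′ k o → 2 * o ≤ k → 3 * k + 1 ≤ 2 * suc n′ → k + n′ * o < 2 ^ n′
nearCount<exp n′ k o 2o≤k 3k+1≤2n = *-cancelˡ-< 6 (k + n′ * o) (2 ^ n′) (begin-strict
  6 * (k + n′ * o)             ≡⟨ regroup k n′ o ⟩
  3 * (2 * k + n′ * (2 * o))   ≤⟨ *-monoʳ-≤ 3 (+-monoʳ-≤ (2 * k) (*-monoʳ-≤ n′ 2o≤k)) ⟩
  3 * (2 * k + n′ * k)         ≡⟨ factor k n′ ⟩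
  (n′ + 2) * (3 * k)           ≤⟨ *-monoʳ-≤ (n′ + 2) 3k≤2n′+1 ⟩
  (n′ + 2) * (2 * n′ + 1)      <⟨ poly<exp n′ ⟩
  6 * 2 ^ n′                   ∎)
  where
  open ≤-Reasoning
  regroup : ∀ k n′ o → 6 * (k + n′ * o) ≡ 3 * (2 * k + n′ * (2 * o))
  regroup = solve-∀
  factor : ∀ k n′ → 3 * (2 * k + n′ * k) ≡ (n′ + 2) * (3 * k)
  factor = solve-∀
  2[1+n′]≡2n′+1+1 : ∀ n′ → 2 * suc n′ ≡ (2 * n′ + 1) + 1
  2[1+n′]≡2n′+1+1 = solve-∀
  3k≤2n′+1 : 3 * k ≤ 2 * n′ + 1
  3k≤2n′+1 = +-cancelʳ-≤ 1 (3 * k) (2 * n′ + 1) (subst (3 * k + 1 ≤_) (2[1+n′]≡2n′+1+1 n′) 3k+1≤2n)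

oddCount+k<n : ∀ n k o → 2 * o ≤ k → 3 * k + 1 ≤ 2 * n → o + k < n
oddCount+k<n n k o 2o≤k 3k+1≤2n = *-cancelˡ-< 2 (o + k) n (begin-strict
  2 * (o + k)      ≡⟨ *-distribˡ-+ 2 o k ⟩
  2 * o + 2 * k    ≤⟨ +-monoˡ-≤ (2 * k) 2o≤k ⟩
  3 * k            <⟨ m<m+n (3 * k) z<s ⟩
  3 * k + 1        ≤⟨ 3k+1≤2n ⟩
  2 * n            ∎)
  where open ≤-Reasoning

initialPosition : ∀ {n k} (Z : Vec (Vec Bool n) k) → 3 * k + 1 ≤ 2 * n → Σ (Vec Bool n) (SurvivorStrategy.Safe Z)
initialPosition {zero}   {k} Z 3k+1≤0 = contradiction (m+n≡0⇒n≡0 (3 * k) (n≤0⇒n≡0 3k+1≤0)) λ ()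
initialPosition {suc n′} {k} Z 3k+1≤2n = s , far , safe
  where
  open SurvivorStrategy {suc n′} {k}
  q : Fin k → Bool
  q i = parity (lookup Z i)
  p : Bool
  p = proj₁ (minorityParity q)
  near : Fin k → Vec Bool (suc n′) → Bool
  near i s = dist (lookup Z i) s <ᵇ 2
  fewNear : ∑ (λ i → count (suc n′) p (near i)) < count (suc n′) p (λ _ → true)
  fewNear = begin-strict
    ∑ (λ i → count (suc n′) p (near i))      ≤⟨ ∑-mono-≤ (λ i → count-dist<2 (lookup Z i) p) ⟩
    ∑ (λ i → nearBound (suc n′) (q i xor p))  ≡⟨ ∑-cong (λ i → nearBound-suc n′ (q i xor p)) ⟩
    ∑ (λ i → suc (n′ * bit (q i xor p)))      ≡⟨ ∑-suc (λ i → n′ * bit (q i xor p)) ⟩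
    k + ∑ (λ i → n′ * bit (q i xor p))        ≡⟨ cong (k +_) (∑-*ˡ n′ (λ i → bit (q i xor p))) ⟩
    k + n′ * oppositeCount q p                <⟨ nearCount<exp n′ k _ (proj₂ (minorityParity q)) 3k+1≤2n ⟩
    2 ^ n′                                    ≡⟨ count-true n′ p ⟨
    count (suc n′) p (λ _ → true)             ∎
    where open ≤-Reasoning
  avoiding : Σ (Vec Bool (suc n′)) λ s → parity s ≡ p × ∀ i → near i s ≡ false
  avoiding = avoidAll (suc n′) p near fewNear
  s : Vec Bool (suc n′)
  s = proj₁ avoiding
  far : ∀ i → 2 ≤ dist (lookup Z i) s
  far i = <ᵇ2≡false⇒2≤ _ (proj₂ (proj₂ avoiding) i)
  oddCount≡ : oddCount Z s ≡ oppositeCount q p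
  oddCount≡ = ∑-cong λ i → cong bit (trans (isOdd-dist (lookup Z i) s) (cong (q i xor_) (proj₁ (proj₂ avoiding))))
  safe : oddCount Z s + k < suc n′
  safe = subst (λ c → c + k < suc n′) (sym oddCount≡) (oddCount+k<n (suc n′) k _ (proj₂ (minorityParity q)) 3k+1≤2n)

<ceil3⇒3*+1≤ : ∀ k m → k < ceil3 m → 3 * k + 1 ≤ m
<ceil3⇒3*+1≤ k m k<⌈m/3⌉ = +-cancelʳ-≤ 2 (3 * k + 1) m (begin
  3 * k + 1 + 2    ≡⟨ rearrange k ⟩
  suc k * 3        ≤⟨ *-monoˡ-≤ 3 k<⌈m/3⌉ ⟩
  ceil3 m * 3      ≤⟨ m/n*n≤m (m + 2) 3 ⟩
  m + 2            ∎)
  where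
  open ≤-Reasoning
  rearrange : ∀ k → 3 * k + 1 + 2 ≡ suc k * 3
  rearrange = solve-∀

survivorEscapes : ∀ n k → k < ceil3 (2 * n) → ¬ ZombiesWin (Q n) k
survivorEscapes n k k<⌈2n/3⌉ (Z , wins) =
  let s , safe = initialPosition Z (<ceil3⇒3*+1≤ k (2 * n) k<⌈2n/3⌉)
  in SurvivorStrategy.evade Z s safe (wins s)

mainTheorem2 : (n : ℕ) → 1 ≤ n → ZombieNumber (Q n) (ceil3 (2 * n))
mainTheorem2 n n≥1 = zombiesWin-hypercube n n≥1 , survivorEscapes n
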